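{- Let $G$ be a graph, $k$ a positive integer, $c$ a $k$-colouring of $G$, and $u,v$ distinct vertices of $G$. Then there is no edge of $\mathcal{K}_k(G)$ between a colouring in $C_{c,u}$ and a colouring in $C_{c,v}$.
   Context: A (proper) $k$-colouring of $G$ is a map $V(G)\to[k]$ giving adjacent vertices different colours. A Kempe swap on a $k$-colouring, for colours $i\neq j$, exchanges $i$ and $j$ on one connected component of the subgraph induced by the vertices coloured $i$ or $j$; it is trivial if it changes the colour of exactly one vertex. $\mathcal{K}_k(G)$ is the graph on the $k$-colourings of $G$ in which two colourings are adjacent iff they differ by one Kempe swap. For a $k$-colouring $c$ and a vertex $w$, $C_{c,w}$ is the set of $k$-colourings obtained from $c$ by a trivial Kempe swap on $w$, i.e. the $k$-colourings differing from $c$ exactly at $w$. -}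

module Defs where

open import Level using (0ℓ)
open import Data.Nat using (ℕ)
open import Data.Fin using (Fin; _≟_)
open import Data.Product using (Σ; ∃; _×_; _,_)
open import Data.Sum using (_⊎_)
open import Relation.Nullary using (¬_; yes; no)
open import Relation.Binary.PropositionalEquality using (_≡_; _≢_)

record Graph : Set₁ where
  field
    n     : ℕ
    Adj   : Fin n → Fin n → Set
    sym   : ∀ {x y} → Adj x y → Adj y x
    irrefl : ∀ {x} → ¬ Adj x x

open Graph public

Vertex : Graph → Set
Vertex G = Fin (n G)

record Colouring (G : Graph) (k : ℕ) : Set where
  constructor colouring
  field
    col    : Vertex G → Fin k
    proper : ∀ {x y} → Adj G x y → col x ≢ col y

open Colouring public

swapCol : ∀ {k} → Fin k → Fin k → Fin k → Fin k
swapCol i j a with a ≟ i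
... | yes _ = j
... | no _ with a ≟ j
...   | yes _ = i
...   | no _ = a

InPair : ∀ {G k} → Colouring G k → Fin k → Fin k → Vertex G → Set
InPair α i j z = (col α z ≡ i) ⊎ (col α z ≡ j)

-- Reach α i j x y : y lies in the connected component containing x of the
-- subgraph induced by the vertices coloured i or j under α.
data Reach {G : Graph} {k : ℕ} (α : Colouring G k) (i j : Fin k) (x : Vertex G) :
           Vertex G → Set where
  here : InPair α i j x → Reach α i j x x
  step : ∀ {y z} → Reach α i j x y → Adj G y z → InPair α i j z → Reach α i j x z

KempeSwap : ∀ {G k} → Colouring G k → Colouring G k → Set
KempeSwap {G} {k} α β =
  Σ (Fin k) λ i → Σ (Fin k) λ j → Σ (Vertex G) λ x →
    (i ≢ j) × InPair α i j x ×
    (∀ y → (Reach α i j x y → col β y ≡ swapCol i j (col α y))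
         × (¬ Reach α i j x y → col β y ≡ col α y))

KAdj : ∀ {G k} → Colouring G k → Colouring G k → Set
KAdj α β = KempeSwap α β

InC : ∀ {G k} → Colouring G k → Vertex G → Colouring G k → Set
InC {G} c w d = (col d w ≢ col c w) × (∀ x → x ≢ w → col d x ≡ col c x)

{-# OPTIONS --safe #-}
-- The colourings d and e differ exactly at u and v, and a Kempe swap recolours exactly the
-- vertices of its component, so that component is {u, v}: u and v are adjacent and the swap
-- exchanges their colours. Hence c u = e u = d v = c v for adjacent u and v, which is
-- impossible since c is proper.
module Submission where

open import Defs hiding (sym)
open import Data.Nat using (ℕ; _≥_)
open import Data.Fin using (Fin; _≟_)
open import Data.Product using (∃; _×_; _,_; proj₁; proj₂)
open import Data.Sum using (_⊎_; inj₁; inj₂; [_,_])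
open import Relation.Nullary using (¬_; yes; no; contradiction)
open import Relation.Binary.PropositionalEquality using (_≡_; _≢_; refl; sym; trans; ≢-sym)

OneOf : ∀ {k} → Fin k → Fin k → Fin k → Set
OneOf i j a = a ≡ i ⊎ a ≡ j

module _ {k} {i j : Fin k} where

  swapCol-moves : i ≢ j → ∀ {a} → OneOf i j a → swapCol i j a ≢ a
  swapCol-moves i≢j {a} a∈ij with a ≟ i
  ... | yes refl = ≢-sym i≢j
  ... | no a≢i with a ≟ j
  ...   | yes refl = i≢j
  ...   | no a≢j = λ _ → [ a≢i , a≢j ] a∈ij

  swapCol-to-other : ∀ {a b} → OneOf i j a → OneOf i j b → a ≢ b → swapCol i j a ≡ b
  swapCol-to-other {a} a∈ij b∈ij a≢b with a ≟ i | b∈ij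
  ... | yes refl | inj₁ refl = contradiction refl a≢b
  ... | yes refl | inj₂ refl = refl
  ... | no a≢i   | _ with a ≟ j | b∈ij
  ...   | yes refl | inj₁ refl = refl
  ...   | yes refl | inj₂ refl = contradiction refl a≢b
  ...   | no a≢j   | _         = contradiction a∈ij [ a≢i , a≢j ]

module _ {G : Graph} {k} {α : Colouring G k} {i j : Fin k} {x : Vertex G} where

  Reach-InPair : ∀ {y} → Reach α i j x y → InPair α i j y
  Reach-InPair (here y∈ij)     = y∈ij
  Reach-InPair (step _ _ y∈ij) = y∈ij

  Reach-lastStep : ∀ {z} → Reach α i j x z → z ≢ x → ∃ λ y → Reach α i j x y × Adj G y z
  Reach-lastStep (here _)             z≢x = contradiction refl z≢x
  Reach-lastStep (step {y} x⇝y y~z _) _   = y , x⇝y , y~z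

  twoVertexComponent⇒Adj : ∀ {u v} → u ≢ v → (∀ {y} → Reach α i j x y → y ≡ u ⊎ y ≡ v) →
                           Reach α i j x u → Reach α i j x v → Adj G u v
  twoVertexComponent⇒Adj {u} {v} u≢v component⊆uv x⇝u x⇝v with x ≟ u
  ... | yes refl with Reach-lastStep x⇝v (≢-sym u≢v)
  ...   | y , x⇝y , y~v with component⊆uv x⇝y
  ...     | inj₁ refl = y~v
  ...     | inj₂ refl = contradiction y~v (irrefl G)
  twoVertexComponent⇒Adj u≢v component⊆uv x⇝u x⇝v | no x≢u with Reach-lastStep x⇝u (≢-sym x≢u)
  ...   | y , x⇝y , y~u with component⊆uv x⇝y
  ...     | inj₁ refl = contradiction y~u (irrefl G)
  ...     | inj₂ refl = Graph.sym G y~u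

SwapsComponent : ∀ {G k} → Colouring G k → Colouring G k → Fin k → Fin k → Vertex G → Set
SwapsComponent α β i j x =
  ∀ y → (Reach α i j x y → col β y ≡ swapCol i j (col α y)) × (¬ Reach α i j x y → col β y ≡ col α y)

module _ {G k} (α β : Colouring G k) {i j : Fin k} {x : Vertex G}
         (i≢j : i ≢ j) (swaps : SwapsComponent α β i j x) where

  Reach⇒recoloured : ∀ {y} → Reach α i j x y → col β y ≢ col α y
  Reach⇒recoloured {y} x⇝y βy≡αy =
    swapCol-moves i≢j (Reach-InPair x⇝y) (trans (sym (proj₁ (swaps y) x⇝y)) βy≡αy)

  recoloured⇒¬¬Reach : ∀ {y} → col β y ≢ col α y → ¬ ¬ Reach α i j x y
  recoloured⇒¬¬Reach {y} βy≢αy ¬x⇝y = βy≢αy (proj₂ (swaps y) ¬x⇝y)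

-- Membership of a Kempe component is not known to be decidable, hence the double negation.
kempeSwap-recolouring-two-vertices : ∀ {G k} (α β : Colouring G k) → KempeSwap α β →
  ∀ {u v} → u ≢ v → col β u ≢ col α u → col β v ≢ col α v →
  (∀ y → y ≢ u → y ≢ v → col β y ≡ col α y) →
  ¬ ¬ (Adj G u v × col β u ≡ col α v)
kempeSwap-recolouring-two-vertices {G} α β (i , j , x , i≢j , _ , swaps)
                                   {u} {v} u≢v βu≢αu βv≢αv unchanged ¬exchanged =
  recoloured⇒¬¬Reach α β i≢j swaps βu≢αu λ x⇝u →
  recoloured⇒¬¬Reach α β i≢j swaps βv≢αv λ x⇝v →
  ¬exchanged (exchanged x⇝u x⇝v)
  where
  component⊆uv : ∀ {y} → Reach α i j x y → y ≡ u ⊎ y ≡ v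
  component⊆uv {y} x⇝y with y ≟ u | y ≟ v
  ... | yes y≡u | _       = inj₁ y≡u
  ... | no _    | yes y≡v = inj₂ y≡v
  ... | no y≢u  | no y≢v  = contradiction (unchanged y y≢u y≢v) (Reach⇒recoloured α β i≢j swaps x⇝y)

  exchanged : Reach α i j x u → Reach α i j x v → Adj G u v × col β u ≡ col α v
  exchanged x⇝u x⇝v = u~v , trans (proj₁ (swaps u) x⇝u) αu↦αv
    where
    u~v : Adj G u v
    u~v = twoVertexComponent⇒Adj u≢v component⊆uv x⇝u x⇝v
    αu↦αv : swapCol i j (col α u) ≡ col α v
    αu↦αv = swapCol-to-other (Reach-InPair x⇝u) (Reach-InPair x⇝v) (proper α u~v)

lemma3p1 : (G : Graph) (k : ℕ) → k ≥ 1 → (c : Colouring G k) →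
             (u v : Vertex G) → u ≢ v →
             (d e : Colouring G k) → InC c u d → InC c v e → ¬ KAdj d e
lemma3p1 G k _ c u v u≢v d e (du≢cu , d≡c) (ev≢cv , e≡c) d→e =
  kempeSwap-recolouring-two-vertices d e d→e u≢v eu≢du ev≢dv unchanged
    λ (u~v , eu≡dv) → proper c u~v (trans (sym eu≡cu) (trans eu≡dv dv≡cv))
  where
  eu≡cu : col e u ≡ col c u
  eu≡cu = e≡c u u≢v
  dv≡cv : col d v ≡ col c v
  dv≡cv = d≡c v (≢-sym u≢v)
  eu≢du : col e u ≢ col d u
  eu≢du eu≡du = du≢cu (trans (sym eu≡du) eu≡cu)
  ev≢dv : col e v ≢ col d v
  ev≢dv ev≡dv = ev≢cv (trans ev≡dv dv≡cv)
  unchanged : ∀ y → y ≢ u → y ≢ v → col e y ≡ col d y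
  unchanged y y≢u y≢v = trans (e≡c y y≢v) (sym (d≡c y y≢u))
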